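{- For all bases $\Gamma$, terms $M,N\in\Lambda_R$ and types $\sigma\in\mathbb{T}$: if $\Gamma\vdash M:\sigma$ and $M\to N$, then $\Gamma\vdash N:\sigma$.
   Context: $\Lambda_R$ terms: $M,N::=x\mid\lambda x.M\mid MN\mid M.l\mid R\mid M\oplus R$, records $R::=\langle l_i=M_i\mid i\in I\rangle$ ($I$ finite, labels pairwise distinct); terms are taken up to $\alpha$-renaming, $M[N/x]$ is capture-avoiding substitution, $\mathrm{lbl}(\langle l_i=M_i\mid i\in I\rangle)=\{l_i\mid i\in I\}$. Reduction $\to$ is the least relation compatible with the term constructors containing: $(\lambda x.M)N\to M[N/x]$; $\langle l_i=M_i\mid i\in I\rangle.l_j\to M_j$ if $j\in I$; $\langle l_i=M_i\mid i\in I\rangle\oplus\langle l_j=N_j\mid j\in J\rangle\to\langle l_i=M_i,\,l_j=N_j\mid i\in I\setminus J,\,j\in J\rangle$. Types $\mathbb{T}$: $\sigma::=a\mid\omega\mid\sigma\to\sigma\mid\sigma\cap\sigma\mid\rho$; record types $\mathbb{T}_R$: $\rho::=\langle\rangle\mid\langle l:\sigma\rangle\mid\rho+\rho\mid\rho\cap\rho$. Subtyping $\le$ is the least preorder with: $\sigma\le\omega$; $\omega\le\omega\to\omega$; $\sigma\cap\tau\le\sigma$; $\sigma\cap\tau\le\tau$; $\sigma\le\tau_1,\sigma\le\tau_2\Rightarrow\sigma\le\tau_1\cap\tau_2$; $(\sigma\to\tau_1)\cap(\sigma\to\tau_2)\le\sigma\to\tau_1\cap\tau_2$; $\sigma_2\le\sigma_1,\tau_1\le\tau_2\Rightarrow\sigma_1\to\tau_1\le\sigma_2\to\tau_2$;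 $\langle l:\sigma\rangle\le\langle\rangle$; $\langle l:\sigma\rangle\cap\langle l:\tau\rangle\le\langle l:\sigma\cap\tau\rangle$; $\sigma\le\tau\Rightarrow\langle l:\sigma\rangle\le\langle l:\tau\rangle$; and, with $\sigma=\tau$ meaning mutual $\le$: $\rho+\langle\rangle=\langle\rangle+\rho=\rho$; $(\rho_1+\rho_2)+\rho_3=\rho_1+(\rho_2+\rho_3)$; $(\rho_1\cap\rho_2)+\rho_3=(\rho_1+\rho_3)\cap(\rho_2+\rho_3)$; $\langle l:\sigma\rangle+(\langle l:\tau\rangle\cap\rho)=\langle l:\tau\rangle\cap\rho$; $\langle l:\sigma\rangle+(\langle l':\tau\rangle\cap\rho)=\langle l':\tau\rangle\cap(\langle l:\sigma\rangle+\rho)$ for $l\neq l'$; $\rho_1\le\rho_2\Rightarrow\rho_1+\rho\le\rho_2+\rho$; $\rho_1=\rho_2\Rightarrow\rho+\rho_1=\rho+\rho_2$. For record types, $\mathrm{lbl}(\langle\rangle)=\emptyset$, $\mathrm{lbl}(\langle l:\sigma\rangle)=\{l\}$, $\mathrm{lbl}(\rho_1\cap\rho_2)=\mathrm{lbl}(\rho_1+\rho_2)=\mathrm{lbl}(\rho_1)\cup\mathrm{lbl}(\rho_2)$. A basis $\Gamma$ is a finite set $\{x_1:\sigma_1,\dots,x_n:\sigma_n\}$ with pairwise distinct variables. Typing rules: $x:\sigma\in\Gamma\Rightarrow\Gamma\vdash x:\sigma$; from $\Gamma,x:\sigma\vdash M:\tau$ infer $\Gamma\vdash\lambda x.M:\sigma\to\tau$;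 from $\Gamma\vdash M:\sigma\to\tau$ and $\Gamma\vdash N:\sigma$ infer $\Gamma\vdash MN:\tau$; from $\Gamma\vdash M:\sigma$ and $\Gamma\vdash M:\tau$ infer $\Gamma\vdash M:\sigma\cap\tau$; $\Gamma\vdash M:\omega$; from $\Gamma\vdash M:\sigma$, $\sigma\le\tau$ infer $\Gamma\vdash M:\tau$; $\Gamma\vdash\langle l_i=M_i\mid i\in I\rangle:\langle\rangle$; from $\Gamma\vdash M_k:\sigma$, $k\in I$ infer $\Gamma\vdash\langle l_i=M_i\mid i\in I\rangle:\langle l_k:\sigma\rangle$; from $\Gamma\vdash M:\langle l:\sigma\rangle$ infer $\Gamma\vdash M.l:\sigma$; from $\Gamma\vdash M:\rho_1$, $\Gamma\vdash R:\rho_2$ and $\mathrm{lbl}(R)=\mathrm{lbl}(\rho_2)$ infer $\Gamma\vdash M\oplus R:\rho_1+\rho_2$. -}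

module Defs where

open import Data.Nat using (ℕ; zero; suc; _≡ᵇ_)
open import Data.Bool using (Bool; true; false; if_then_else_; _∨_)
open import Data.List using (List; []; _∷_; _++_)
open import Data.List.Membership.Propositional using (_∈_)
open import Data.List.Relation.Unary.Unique.Propositional using (Unique)
open import Data.List.Relation.Unary.All using (All)
open import Data.Product using (_×_)
open import Relation.Binary.PropositionalEquality using (_≡_; _≢_)

-- Terms of Λ_R (de Bruijn indices: terms up to α-renaming)

Label : Set
Label = ℕ

infixl 7 _·_
infixl 8 _∙_

mutual
  data Term : Set where
    var  : ℕ → Term
    ƛ_   : Term → Term
    _·_  : Term → Term → Term
    _∙_  : Term → Label → Term
    rec  : Fields → Term
    _⊕_  : Term → Fields → Term

  data Fields : Set where
    fnil  : Fields
    fcons : Label → Term → Fields → Fields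

lblF : Fields → List Label
lblF fnil          = []
lblF (fcons l _ R) = l ∷ lblF R

mutual
  data WF : Term → Set where
    wf-var : ∀ {x} → WF (var x)
    wf-ƛ   : ∀ {M} → WF M → WF (ƛ M)
    wf-·   : ∀ {M N} → WF M → WF N → WF (M · N)
    wf-∙   : ∀ {M l} → WF M → WF (M ∙ l)
    wf-rec : ∀ {R} → WFF R → Unique (lblF R) → WF (rec R)
    wf-⊕   : ∀ {M R} → WF M → WFF R → Unique (lblF R) → WF (M ⊕ R)

  data WFF : Fields → Set where
    wf-fnil  : WFF fnil
    wf-fcons : ∀ {l M R} → WF M → WFF R → WFF (fcons l M R)

data _∋ᶠ_↦_ : Fields → Label → Term → Set where
  fhere  : ∀ {l M R} → fcons l M R ∋ᶠ l ↦ M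
  fthere : ∀ {l M l' M' R} → R ∋ᶠ l ↦ M → fcons l' M' R ∋ᶠ l ↦ M

extR : (ℕ → ℕ) → ℕ → ℕ
extR ρ zero    = zero
extR ρ (suc n) = suc (ρ n)

mutual
  rename : (ℕ → ℕ) → Term → Term
  rename ρ (var x)   = var (ρ x)
  rename ρ (ƛ M)     = ƛ rename (extR ρ) M
  rename ρ (M · N)   = rename ρ M · rename ρ N
  rename ρ (M ∙ l)   = rename ρ M ∙ l
  rename ρ (rec R)   = rec (renameF ρ R)
  rename ρ (M ⊕ R)   = rename ρ M ⊕ renameF ρ R

  renameF : (ℕ → ℕ) → Fields → Fields
  renameF ρ fnil          = fnil
  renameF ρ (fcons l M R) = fcons l (rename ρ M) (renameF ρ R)

exts : (ℕ → Term) → ℕ → Term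
exts s zero    = var zero
exts s (suc n) = rename suc (s n)

mutual
  subst : (ℕ → Term) → Term → Term
  subst s (var x)   = s x
  subst s (ƛ M)     = ƛ subst (exts s) M
  subst s (M · N)   = subst s M · subst s N
  subst s (M ∙ l)   = subst s M ∙ l
  subst s (rec R)   = rec (substF s R)
  subst s (M ⊕ R)   = subst s M ⊕ substF s R

  substF : (ℕ → Term) → Fields → Fields
  substF s fnil          = fnil
  substF s (fcons l M R) = fcons l (subst s M) (substF s R)

subst-zero : Term → ℕ → Term
subst-zero N zero    = N
subst-zero N (suc n) = var n

-- M [ N ]  is  M[N/x] where x is the variable bound by the enclosing λ
_[_] : Term → Term → Term
M [ N ] = subst (subst-zero N) M

-- Record merge  ⟨l_i = M_i | i ∈ I⟩ ⊕ ⟨l_j = N_j | j ∈ J⟩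
--   → ⟨l_i = M_i, l_j = N_j | i ∈ I \ J, j ∈ J⟩

elem : Label → List Label → Bool
elem l []       = false
elem l (k ∷ ks) = (l ≡ᵇ k) ∨ elem l ks

removeL : List Label → Fields → Fields
removeL ls fnil          = fnil
removeL ls (fcons l M R) =
  if elem l ls then removeL ls R else fcons l M (removeL ls R)

_++F_ : Fields → Fields → Fields
fnil          ++F S = S
fcons l M R   ++F S = fcons l M (R ++F S)

mergeF : Fields → Fields → Fields
mergeF R S = removeL (lblF S) R ++F S

infix 4 _⟶_ _⟶ᶠ_

mutual
  data _⟶_ : Term → Term → Set where
    β     : ∀ {M N} → (ƛ M) · N ⟶ M [ N ]
    proj  : ∀ {R l M} → R ∋ᶠ l ↦ M → rec R ∙ l ⟶ M
    merge : ∀ {R S} → rec R ⊕ S ⟶ rec (mergeF R S)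
    ξ-ƛ   : ∀ {M M'} → M ⟶ M' → ƛ M ⟶ ƛ M'
    ξ-·₁  : ∀ {M M' N} → M ⟶ M' → M · N ⟶ M' · N
    ξ-·₂  : ∀ {M N N'} → N ⟶ N' → M · N ⟶ M · N'
    ξ-∙   : ∀ {M M' l} → M ⟶ M' → M ∙ l ⟶ M' ∙ l
    ξ-rec : ∀ {R R'} → R ⟶ᶠ R' → rec R ⟶ rec R'
    ξ-⊕₁  : ∀ {M M' R} → M ⟶ M' → M ⊕ R ⟶ M' ⊕ R
    ξ-⊕₂  : ∀ {M R R'} → R ⟶ᶠ R' → M ⊕ R ⟶ M ⊕ R'

  data _⟶ᶠ_ : Fields → Fields → Set where
    fstep-here  : ∀ {l M M' R} → M ⟶ M' → fcons l M R ⟶ᶠ fcons l M' R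
    fstep-there : ∀ {l M R R'} → R ⟶ᶠ R' → fcons l M R ⟶ᶠ fcons l M R'

-- Types: raw syntax, with predicates carving out 𝕋 and 𝕋_R

infixr 5 _⇒_
infixl 6 _∩_
infixl 7 _+ᵣ_

data Ty : Set where
  atom   : ℕ → Ty
  ω      : Ty
  _⇒_    : Ty → Ty → Ty
  _∩_    : Ty → Ty → Ty
  ⟨⟩     : Ty
  ⟨_∶_⟩  : Label → Ty → Ty
  _+ᵣ_   : Ty → Ty → Ty

mutual
  data Typ : Ty → Set where
    t-atom : ∀ {a} → Typ (atom a)
    t-ω    : Typ ω
    t-⇒    : ∀ {σ τ} → Typ σ → Typ τ → Typ (σ ⇒ τ)
    t-∩    : ∀ {σ τ} → Typ σ → Typ τ → Typ (σ ∩ τ)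
    t-rec  : ∀ {ρ} → Rec ρ → Typ ρ

  data Rec : Ty → Set where
    r-⟨⟩ : Rec ⟨⟩
    r-fld : ∀ {l σ} → Typ σ → Rec ⟨ l ∶ σ ⟩
    r-+  : ∀ {ρ₁ ρ₂} → Rec ρ₁ → Rec ρ₂ → Rec (ρ₁ +ᵣ ρ₂)
    r-∩  : ∀ {ρ₁ ρ₂} → Rec ρ₁ → Rec ρ₂ → Rec (ρ₁ ∩ ρ₂)

lblT : Ty → List Label
lblT ⟨⟩          = []
lblT ⟨ l ∶ _ ⟩   = l ∷ []
lblT (ρ₁ ∩ ρ₂)   = lblT ρ₁ ++ lblT ρ₂
lblT (ρ₁ +ᵣ ρ₂)  = lblT ρ₁ ++ lblT ρ₂
lblT _           = []

SameLabels : List Label → List Label → Set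
SameLabels xs ys = (∀ l → l ∈ xs → l ∈ ys) × (∀ l → l ∈ ys → l ∈ xs)

infix 4 _≤_

data _≤_ : Ty → Ty → Set where
  ≤-refl  : ∀ {σ} → Typ σ → σ ≤ σ
  ≤-trans : ∀ {σ τ υ} → σ ≤ τ → τ ≤ υ → σ ≤ υ
  ≤-ω     : ∀ {σ} → Typ σ → σ ≤ ω
  ≤-ωω    : ω ≤ ω ⇒ ω
  ≤-∩l    : ∀ {σ τ} → Typ σ → Typ τ → σ ∩ τ ≤ σ
  ≤-∩r    : ∀ {σ τ} → Typ σ → Typ τ → σ ∩ τ ≤ τ
  ≤-glb   : ∀ {σ τ₁ τ₂} → σ ≤ τ₁ → σ ≤ τ₂ → σ ≤ τ₁ ∩ τ₂
  ≤-⇒∩    : ∀ {σ τ₁ τ₂} → Typ σ → Typ τ₁ → Typ τ₂ →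
            (σ ⇒ τ₁) ∩ (σ ⇒ τ₂) ≤ σ ⇒ τ₁ ∩ τ₂
  ≤-⇒     : ∀ {σ₁ σ₂ τ₁ τ₂} → σ₂ ≤ σ₁ → τ₁ ≤ τ₂ → σ₁ ⇒ τ₁ ≤ σ₂ ⇒ τ₂
  ≤-fld⟨⟩ : ∀ {l σ} → Typ σ → ⟨ l ∶ σ ⟩ ≤ ⟨⟩
  ≤-fld∩  : ∀ {l σ τ} → Typ σ → Typ τ → ⟨ l ∶ σ ⟩ ∩ ⟨ l ∶ τ ⟩ ≤ ⟨ l ∶ σ ∩ τ ⟩
  ≤-fld   : ∀ {l σ τ} → σ ≤ τ → ⟨ l ∶ σ ⟩ ≤ ⟨ l ∶ τ ⟩
  ≤-unitr₁ : ∀ {ρ} → Rec ρ → ρ +ᵣ ⟨⟩ ≤ ρ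
  ≤-unitr₂ : ∀ {ρ} → Rec ρ → ρ ≤ ρ +ᵣ ⟨⟩
  ≤-unitl₁ : ∀ {ρ} → Rec ρ → ⟨⟩ +ᵣ ρ ≤ ρ
  ≤-unitl₂ : ∀ {ρ} → Rec ρ → ρ ≤ ⟨⟩ +ᵣ ρ
  ≤-assoc₁ : ∀ {ρ₁ ρ₂ ρ₃} → Rec ρ₁ → Rec ρ₂ → Rec ρ₃ →
             (ρ₁ +ᵣ ρ₂) +ᵣ ρ₃ ≤ ρ₁ +ᵣ (ρ₂ +ᵣ ρ₃)
  ≤-assoc₂ : ∀ {ρ₁ ρ₂ ρ₃} → Rec ρ₁ → Rec ρ₂ → Rec ρ₃ →
             ρ₁ +ᵣ (ρ₂ +ᵣ ρ₃) ≤ (ρ₁ +ᵣ ρ₂) +ᵣ ρ₃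
  ≤-dist₁ : ∀ {ρ₁ ρ₂ ρ₃} → Rec ρ₁ → Rec ρ₂ → Rec ρ₃ →
            (ρ₁ ∩ ρ₂) +ᵣ ρ₃ ≤ (ρ₁ +ᵣ ρ₃) ∩ (ρ₂ +ᵣ ρ₃)
  ≤-dist₂ : ∀ {ρ₁ ρ₂ ρ₃} → Rec ρ₁ → Rec ρ₂ → Rec ρ₃ →
            (ρ₁ +ᵣ ρ₃) ∩ (ρ₂ +ᵣ ρ₃) ≤ (ρ₁ ∩ ρ₂) +ᵣ ρ₃
  ≤-over₁ : ∀ {l σ τ ρ} → Typ σ → Typ τ → Rec ρ →
            ⟨ l ∶ σ ⟩ +ᵣ (⟨ l ∶ τ ⟩ ∩ ρ) ≤ ⟨ l ∶ τ ⟩ ∩ ρ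
  ≤-over₂ : ∀ {l σ τ ρ} → Typ σ → Typ τ → Rec ρ →
            ⟨ l ∶ τ ⟩ ∩ ρ ≤ ⟨ l ∶ σ ⟩ +ᵣ (⟨ l ∶ τ ⟩ ∩ ρ)
  ≤-swap₁ : ∀ {l l' σ τ ρ} → l ≢ l' → Typ σ → Typ τ → Rec ρ →
            ⟨ l ∶ σ ⟩ +ᵣ (⟨ l' ∶ τ ⟩ ∩ ρ) ≤ ⟨ l' ∶ τ ⟩ ∩ (⟨ l ∶ σ ⟩ +ᵣ ρ)
  ≤-swap₂ : ∀ {l l' σ τ ρ} → l ≢ l' → Typ σ → Typ τ → Rec ρ →
            ⟨ l' ∶ τ ⟩ ∩ (⟨ l ∶ σ ⟩ +ᵣ ρ) ≤ ⟨ l ∶ σ ⟩ +ᵣ (⟨ l' ∶ τ ⟩ ∩ ρ)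
  ≤-+l    : ∀ {ρ₁ ρ₂ ρ} → Rec ρ₁ → Rec ρ₂ → Rec ρ →
            ρ₁ ≤ ρ₂ → ρ₁ +ᵣ ρ ≤ ρ₂ +ᵣ ρ
  -- ρ₁ = ρ₂ ⇒ ρ + ρ₁ = ρ + ρ₂  (the reverse direction is the symmetric instance)
  ≤-+r    : ∀ {ρ₁ ρ₂ ρ} → Rec ρ₁ → Rec ρ₂ → Rec ρ →
            ρ₁ ≤ ρ₂ → ρ₂ ≤ ρ₁ → ρ +ᵣ ρ₁ ≤ ρ +ᵣ ρ₂

-- Bases (de Bruijn: the i-th entry types variable i) and typing

Basis : Set
Basis = List Ty

WFBasis : Basis → Set
WFBasis Γ = All Typ Γ

data _∋_∶_ : Basis → ℕ → Ty → Set where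
  vhere  : ∀ {Γ σ} → (σ ∷ Γ) ∋ zero ∶ σ
  vthere : ∀ {Γ x σ τ} → Γ ∋ x ∶ σ → (τ ∷ Γ) ∋ suc x ∶ σ

infix 3 _⊢_∶_

data _⊢_∶_ : Basis → Term → Ty → Set where
  ⊢var : ∀ {Γ x σ} → Γ ∋ x ∶ σ → Γ ⊢ var x ∶ σ
  ⊢ƛ   : ∀ {Γ M σ τ} → Typ σ → (σ ∷ Γ) ⊢ M ∶ τ → Γ ⊢ ƛ M ∶ σ ⇒ τ
  ⊢·   : ∀ {Γ M N σ τ} → Γ ⊢ M ∶ σ ⇒ τ → Γ ⊢ N ∶ σ → Γ ⊢ M · N ∶ τ
  ⊢∩   : ∀ {Γ M σ τ} → Γ ⊢ M ∶ σ → Γ ⊢ M ∶ τ → Γ ⊢ M ∶ σ ∩ τ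
  ⊢ω   : ∀ {Γ M} → Γ ⊢ M ∶ ω
  ⊢≤   : ∀ {Γ M σ τ} → Γ ⊢ M ∶ σ → σ ≤ τ → Γ ⊢ M ∶ τ
  ⊢⟨⟩  : ∀ {Γ R} → Γ ⊢ rec R ∶ ⟨⟩
  ⊢fld : ∀ {Γ R l M σ} → R ∋ᶠ l ↦ M → Γ ⊢ M ∶ σ → Γ ⊢ rec R ∶ ⟨ l ∶ σ ⟩
  ⊢sel : ∀ {Γ M l σ} → Γ ⊢ M ∶ ⟨ l ∶ σ ⟩ → Γ ⊢ M ∙ l ∶ σ
  ⊢⊕   : ∀ {Γ M R ρ₁ ρ₂} → Rec ρ₁ → Rec ρ₂ →
         Γ ⊢ M ∶ ρ₁ → Γ ⊢ rec R ∶ ρ₂ → SameLabels (lblF R) (lblT ρ₂) →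
         Γ ⊢ M ⊕ R ∶ ρ₁ +ᵣ ρ₂

-- Subject reduction goes by induction on the typing derivation; the work is in
-- inverting the typings of the two kinds of redex, which subsumption obstructs.
-- Each is handled by a predicate on types that holds of every derivable type and
-- is closed under ≤. For ƛ M, an arrow σ ⇒ τ demands M [ N ] ∶ τ for all N ∶ σ,
-- so β needs only the substitution lemma. For a record R, ⟨ l ∶ σ ⟩ demands a
-- field l = M with M ∶ σ, where in ρ₁ +ᵣ ρ₂ the labels of ρ₂ excuse ρ₁ from its
-- fields; closure under ⟨ l ∶ σ ⟩ ∩ ⟨ l ∶ τ ⟩ ≤ ⟨ l ∶ σ ∩ τ ⟩ is where distinct
-- labels are needed. The merge case also needs the converse, that a record type
-- realised by R is derivable for rec R: every record type is equivalent to a flat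
-- intersection of single-field types, each of which the field rule derives.

module Submission where

open import Defs
open import Data.Nat using (ℕ; suc; _≡ᵇ_) renaming (_≟_ to _≟ℕ_)
open import Data.Nat.Properties using (≡ᵇ⇒≡)
open import Data.Bool using (true; false; T)
open import Data.List using (List; []; _∷_; _++_; map)
open import Data.List.Properties using (++-assoc; map-++)
open import Data.List.Membership.Propositional using (_∈_; _∉_)
open import Data.List.Membership.Propositional.Properties using (∈-++⁻)
open import Data.List.Membership.DecPropositional _≟ℕ_ using (_∈?_)
open import Data.List.Relation.Binary.Subset.Propositional using (_⊆_)
open import Data.List.Relation.Binary.Subset.Propositional.Properties
  using (⊆-refl; ⊆-trans; ⊆-reflexive; xs⊆xs++ys; xs⊆ys++xs; ++⁺ˡ; ++⁺ʳ; ∈-∷⁺ʳ)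
open import Data.List.Relation.Unary.Any using (here; there)
open import Data.List.Relation.Unary.All using (All; []; _∷_) renaming (lookup to All-lookup)
open import Data.List.Relation.Unary.All.Properties using () renaming (++⁺ to All-++⁺)
open import Data.List.Relation.Unary.Unique.Propositional using (Unique)
open import Data.List.Relation.Unary.AllPairs using (_∷_)
open import Data.Product using (Σ-syntax; _×_; _,_; proj₁; proj₂)
open import Data.Sum using (_⊎_; inj₁; inj₂; [_,_])
open import Data.Empty using (⊥-elim)
open import Data.Unit using (⊤; tt)
open import Relation.Nullary using (yes; no)
open import Relation.Binary.PropositionalEquality
  using (_≡_; refl; sym; cong) renaming (subst to ≡-subst)

≤⇒Typ : ∀ {σ τ} → σ ≤ τ → Typ σ × Typ τ
≤⇒Typ (≤-refl t) = t , t
≤⇒Typ (≤-trans s t) = proj₁ (≤⇒Typ s) , proj₂ (≤⇒Typ t)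
≤⇒Typ (≤-ω t) = t , t-ω
≤⇒Typ ≤-ωω = t-ω , t-⇒ t-ω t-ω
≤⇒Typ (≤-∩l a b) = t-∩ a b , a
≤⇒Typ (≤-∩r a b) = t-∩ a b , b
≤⇒Typ (≤-glb s t) = proj₁ (≤⇒Typ s) , t-∩ (proj₂ (≤⇒Typ s)) (proj₂ (≤⇒Typ t))
≤⇒Typ (≤-⇒∩ a b c) = t-∩ (t-⇒ a b) (t-⇒ a c) , t-⇒ a (t-∩ b c)
≤⇒Typ (≤-⇒ s t) = t-⇒ (proj₂ (≤⇒Typ s)) (proj₁ (≤⇒Typ t)) , t-⇒ (proj₁ (≤⇒Typ s)) (proj₂ (≤⇒Typ t))
≤⇒Typ (≤-fld⟨⟩ a) = t-rec (r-fld a) , t-rec r-⟨⟩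
≤⇒Typ (≤-fld∩ a b) = t-rec (r-∩ (r-fld a) (r-fld b)) , t-rec (r-fld (t-∩ a b))
≤⇒Typ (≤-fld s) = t-rec (r-fld (proj₁ (≤⇒Typ s))) , t-rec (r-fld (proj₂ (≤⇒Typ s)))
≤⇒Typ (≤-unitr₁ r) = t-rec (r-+ r r-⟨⟩) , t-rec r
≤⇒Typ (≤-unitr₂ r) = t-rec r , t-rec (r-+ r r-⟨⟩)
≤⇒Typ (≤-unitl₁ r) = t-rec (r-+ r-⟨⟩ r) , t-rec r
≤⇒Typ (≤-unitl₂ r) = t-rec r , t-rec (r-+ r-⟨⟩ r)
≤⇒Typ (≤-assoc₁ a b c) = t-rec (r-+ (r-+ a b) c) , t-rec (r-+ a (r-+ b c))
≤⇒Typ (≤-assoc₂ a b c) = t-rec (r-+ a (r-+ b c)) , t-rec (r-+ (r-+ a b) c)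
≤⇒Typ (≤-dist₁ a b c) = t-rec (r-+ (r-∩ a b) c) , t-rec (r-∩ (r-+ a c) (r-+ b c))
≤⇒Typ (≤-dist₂ a b c) = t-rec (r-∩ (r-+ a c) (r-+ b c)) , t-rec (r-+ (r-∩ a b) c)
≤⇒Typ (≤-over₁ a b c) = t-rec (r-+ (r-fld a) (r-∩ (r-fld b) c)) , t-rec (r-∩ (r-fld b) c)
≤⇒Typ (≤-over₂ a b c) = t-rec (r-∩ (r-fld b) c) , t-rec (r-+ (r-fld a) (r-∩ (r-fld b) c))
≤⇒Typ (≤-swap₁ _ a b c) = t-rec (r-+ (r-fld a) (r-∩ (r-fld b) c)) , t-rec (r-∩ (r-fld b) (r-+ (r-fld a) c))
≤⇒Typ (≤-swap₂ _ a b c) = t-rec (r-∩ (r-fld b) (r-+ (r-fld a) c)) , t-rec (r-+ (r-fld a) (r-∩ (r-fld b) c))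
≤⇒Typ (≤-+l a b c _) = t-rec (r-+ a c) , t-rec (r-+ b c)
≤⇒Typ (≤-+r a b c _ _) = t-rec (r-+ c a) , t-rec (r-+ c b)

infix 4 _≃_

_≃_ : Ty → Ty → Set
σ ≃ τ = σ ≤ τ × τ ≤ σ

≃-refl : ∀ {σ} → Typ σ → σ ≃ σ
≃-refl t = ≤-refl t , ≤-refl t

≃-sym : ∀ {σ τ} → σ ≃ τ → τ ≃ σ
≃-sym (p , q) = q , p

≃-trans : ∀ {σ τ υ} → σ ≃ τ → τ ≃ υ → σ ≃ υ
≃-trans (p , q) (r , s) = ≤-trans p r , ≤-trans s q

∩-mono : ∀ {σ σ' τ τ'} → σ ≤ σ' → τ ≤ τ' → σ ∩ τ ≤ σ' ∩ τ'
∩-mono p q = ≤-glb (≤-trans (≤-∩l tσ tτ) p) (≤-trans (≤-∩r tσ tτ) q)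
  where
    tσ = proj₁ (≤⇒Typ p)
    tτ = proj₁ (≤⇒Typ q)

∩-cong : ∀ {σ σ' τ τ'} → σ ≃ σ' → τ ≃ τ' → σ ∩ τ ≃ σ' ∩ τ'
∩-cong (p , p') (q , q') = ∩-mono p q , ∩-mono p' q'

∩-assoc : ∀ {σ τ υ} → Typ σ → Typ τ → Typ υ → σ ∩ (τ ∩ υ) ≃ (σ ∩ τ) ∩ υ
∩-assoc tσ tτ tυ =
  ≤-glb (∩-mono (≤-refl tσ) (≤-∩l tτ tυ)) (≤-trans (≤-∩r tσ tτυ) (≤-∩r tτ tυ)) ,
  ≤-glb (≤-trans (≤-∩l tστ tυ) (≤-∩l tσ tτ)) (∩-mono (≤-∩r tσ tτ) (≤-refl tυ))
  where
    tτυ = t-∩ tτ tυ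
    tστ = t-∩ tσ tτ

x∩yz≃y∩xz : ∀ {σ τ υ} → Typ σ → Typ τ → Typ υ → σ ∩ (τ ∩ υ) ≃ τ ∩ (σ ∩ υ)
x∩yz≃y∩xz tσ tτ tυ =
  ≤-glb (≤-trans (≤-∩r tσ (t-∩ tτ tυ)) (≤-∩l tτ tυ)) (∩-mono (≤-refl tσ) (≤-∩r tτ tυ)) ,
  ≤-glb (≤-trans (≤-∩r tτ (t-∩ tσ tυ)) (≤-∩l tσ tυ)) (∩-mono (≤-refl tτ) (≤-∩r tσ tυ))

lblF-renameF : ∀ ρ R → lblF (renameF ρ R) ≡ lblF R
lblF-renameF ρ fnil = refl
lblF-renameF ρ (fcons l _ R) = cong (l ∷_) (lblF-renameF ρ R)

lblF-substF : ∀ s R → lblF (substF s R) ≡ lblF R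
lblF-substF s fnil = refl
lblF-substF s (fcons l _ R) = cong (l ∷_) (lblF-substF s R)

renameF-lookup : ∀ {ρ R l M} → R ∋ᶠ l ↦ M → renameF ρ R ∋ᶠ l ↦ rename ρ M
renameF-lookup fhere = fhere
renameF-lookup (fthere p) = fthere (renameF-lookup p)

substF-lookup : ∀ {s R l M} → R ∋ᶠ l ↦ M → substF s R ∋ᶠ l ↦ subst s M
substF-lookup fhere = fhere
substF-lookup (fthere p) = fthere (substF-lookup p)

Renaming : (ℕ → ℕ) → Basis → Basis → Set
Renaming ρ Γ Δ = ∀ {x σ} → Γ ∋ x ∶ σ → Δ ∋ ρ x ∶ σ

Renaming-extR : ∀ {ρ Γ Δ τ} → Renaming ρ Γ Δ → Renaming (extR ρ) (τ ∷ Γ) (τ ∷ Δ)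
Renaming-extR r vhere = vhere
Renaming-extR r (vthere p) = vthere (r p)

⊢-rename : ∀ {ρ Γ Δ M σ} → Renaming ρ Γ Δ → Γ ⊢ M ∶ σ → Δ ⊢ rename ρ M ∶ σ
⊢-rename r (⊢var p) = ⊢var (r p)
⊢-rename r (⊢ƛ t d) = ⊢ƛ t (⊢-rename (Renaming-extR r) d)
⊢-rename r (⊢· d e) = ⊢· (⊢-rename r d) (⊢-rename r e)
⊢-rename r (⊢∩ d e) = ⊢∩ (⊢-rename r d) (⊢-rename r e)
⊢-rename r ⊢ω = ⊢ω
⊢-rename r (⊢≤ d s) = ⊢≤ (⊢-rename r d) s
⊢-rename r ⊢⟨⟩ = ⊢⟨⟩
⊢-rename r (⊢fld p d) = ⊢fld (renameF-lookup p) (⊢-rename r d)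
⊢-rename r (⊢sel d) = ⊢sel (⊢-rename r d)
⊢-rename {ρ} r (⊢⊕ {R = R} a b d e sl) =
  ⊢⊕ a b (⊢-rename r d) (⊢-rename r e)
     (≡-subst (λ ls → SameLabels ls _) (sym (lblF-renameF ρ R)) sl)

⊢-weaken : ∀ {Γ M σ τ} → Γ ⊢ M ∶ σ → (τ ∷ Γ) ⊢ rename suc M ∶ σ
⊢-weaken = ⊢-rename vthere

Substitution : (ℕ → Term) → Basis → Basis → Set
Substitution s Γ Δ = ∀ {x σ} → Γ ∋ x ∶ σ → Δ ⊢ s x ∶ σ

Substitution-exts : ∀ {s Γ Δ τ} → Substitution s Γ Δ → Substitution (exts s) (τ ∷ Γ) (τ ∷ Δ)
Substitution-exts h vhere = ⊢var vhere
Substitution-exts h (vthere p) = ⊢-weaken (h p)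

⊢-subst : ∀ {s Γ Δ M σ} → Substitution s Γ Δ → Γ ⊢ M ∶ σ → Δ ⊢ subst s M ∶ σ
⊢-subst h (⊢var p) = h p
⊢-subst h (⊢ƛ t d) = ⊢ƛ t (⊢-subst (Substitution-exts h) d)
⊢-subst h (⊢· d e) = ⊢· (⊢-subst h d) (⊢-subst h e)
⊢-subst h (⊢∩ d e) = ⊢∩ (⊢-subst h d) (⊢-subst h e)
⊢-subst h ⊢ω = ⊢ω
⊢-subst h (⊢≤ d s) = ⊢≤ (⊢-subst h d) s
⊢-subst h ⊢⟨⟩ = ⊢⟨⟩
⊢-subst h (⊢fld p d) = ⊢fld (substF-lookup p) (⊢-subst h d)
⊢-subst h (⊢sel d) = ⊢sel (⊢-subst h d)
⊢-subst {s} h (⊢⊕ {R = R} a b d e sl) =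
  ⊢⊕ a b (⊢-subst h d) (⊢-subst h e)
     (≡-subst (λ ls → SameLabels ls _) (sym (lblF-substF s R)) sl)

⊢-[] : ∀ {Γ M N σ τ} → (σ ∷ Γ) ⊢ M ∶ τ → Γ ⊢ N ∶ σ → Γ ⊢ M [ N ] ∶ τ
⊢-[] {Γ} {N = N} {σ} d e = ⊢-subst N/0 d
  where
    N/0 : Substitution (subst-zero N) (σ ∷ Γ) Γ
    N/0 vhere = e
    N/0 (vthere p) = ⊢var p

Body : Basis → Term → Ty → Set
Body Γ M (σ ⇒ τ) = ∀ {N} → Γ ⊢ N ∶ σ → Γ ⊢ M [ N ] ∶ τ
Body Γ M (σ ∩ τ) = Body Γ M σ × Body Γ M τ
Body Γ M _ = ⊤

Rec⇒Body : ∀ {Γ M ρ} → Rec ρ → Body Γ M ρ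
Rec⇒Body r-⟨⟩ = tt
Rec⇒Body (r-fld _) = tt
Rec⇒Body (r-+ _ _) = tt
Rec⇒Body (r-∩ a b) = Rec⇒Body a , Rec⇒Body b

Body-≤ : ∀ {Γ M σ τ} → σ ≤ τ → Body Γ M σ → Body Γ M τ
Body-≤ (≤-refl _) o = o
Body-≤ (≤-trans s t) o = Body-≤ t (Body-≤ s o)
Body-≤ (≤-ω _) o = tt
Body-≤ ≤-ωω o = λ _ → ⊢ω
Body-≤ (≤-∩l _ _) (o , _) = o
Body-≤ (≤-∩r _ _) (_ , o) = o
Body-≤ (≤-glb s t) o = Body-≤ s o , Body-≤ t o
Body-≤ (≤-⇒∩ _ _ _) (f , g) = λ e → ⊢∩ (f e) (g e)
Body-≤ (≤-⇒ s t) f = λ e → ⊢≤ (f (⊢≤ e s)) t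
Body-≤ (≤-fld⟨⟩ _) o = tt
Body-≤ (≤-fld∩ _ _) o = tt
Body-≤ (≤-fld _) o = tt
Body-≤ (≤-unitr₁ r) o = Rec⇒Body r
Body-≤ (≤-unitr₂ _) o = tt
Body-≤ (≤-unitl₁ r) o = Rec⇒Body r
Body-≤ (≤-unitl₂ _) o = tt
Body-≤ (≤-assoc₁ _ _ _) o = tt
Body-≤ (≤-assoc₂ _ _ _) o = tt
Body-≤ (≤-dist₁ _ _ _) o = tt , tt
Body-≤ (≤-dist₂ _ _ _) o = tt
Body-≤ (≤-over₁ _ _ r) o = tt , Rec⇒Body r
Body-≤ (≤-over₂ _ _ _) o = tt
Body-≤ (≤-swap₁ _ _ _ _) o = tt , tt
Body-≤ (≤-swap₂ _ _ _ _) o = tt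
Body-≤ (≤-+l _ _ _ _) o = tt
Body-≤ (≤-+r _ _ _ _ _) o = tt

⊢ƛ⇒Body : ∀ {Γ M σ} → Γ ⊢ ƛ M ∶ σ → Body Γ M σ
⊢ƛ⇒Body (⊢ƛ _ d) = ⊢-[] d
⊢ƛ⇒Body (⊢∩ d e) = ⊢ƛ⇒Body d , ⊢ƛ⇒Body e
⊢ƛ⇒Body ⊢ω = tt
⊢ƛ⇒Body (⊢≤ d s) = Body-≤ s (⊢ƛ⇒Body d)

++-lub : ∀ {xs ys zs : List Label} → xs ⊆ zs → ys ⊆ zs → xs ++ ys ⊆ zs
++-lub {xs} p q r = [ p , q ] (∈-++⁻ xs r)

lblT-antitone : ∀ {σ τ} → σ ≤ τ → lblT τ ⊆ lblT σ
lblT-antitone (≤-refl _) = ⊆-refl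
lblT-antitone (≤-trans s t) = ⊆-trans (lblT-antitone t) (lblT-antitone s)
lblT-antitone (≤-ω _) ()
lblT-antitone ≤-ωω ()
lblT-antitone (≤-∩l {σ} {τ} _ _) = xs⊆xs++ys (lblT σ) (lblT τ)
lblT-antitone (≤-∩r {σ} {τ} _ _) = xs⊆ys++xs (lblT τ) (lblT σ)
lblT-antitone (≤-glb s t) = ++-lub (lblT-antitone s) (lblT-antitone t)
lblT-antitone (≤-⇒∩ _ _ _) ()
lblT-antitone (≤-⇒ _ _) ()
lblT-antitone (≤-fld⟨⟩ _) ()
lblT-antitone (≤-fld∩ _ _) = xs⊆xs++ys _ _
lblT-antitone (≤-fld _) = ⊆-refl
lblT-antitone (≤-unitr₁ {ρ} _) = xs⊆xs++ys (lblT ρ) []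
lblT-antitone (≤-unitr₂ {ρ} _) = ++-lub ⊆-refl λ ()
lblT-antitone (≤-unitl₁ _) = ⊆-refl
lblT-antitone (≤-unitl₂ _) = ⊆-refl
lblT-antitone (≤-assoc₁ {ρ₁} {ρ₂} {ρ₃} _ _ _) =
  ⊆-reflexive (sym (++-assoc (lblT ρ₁) (lblT ρ₂) (lblT ρ₃)))
lblT-antitone (≤-assoc₂ {ρ₁} {ρ₂} {ρ₃} _ _ _) =
  ⊆-reflexive (++-assoc (lblT ρ₁) (lblT ρ₂) (lblT ρ₃))
lblT-antitone (≤-dist₁ {ρ₁} {ρ₂} {ρ₃} _ _ _) =
  ++-lub (++⁺ˡ (lblT ρ₃) (xs⊆xs++ys (lblT ρ₁) (lblT ρ₂)))
         (++⁺ˡ (lblT ρ₃) (xs⊆ys++xs (lblT ρ₂) (lblT ρ₁)))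
lblT-antitone (≤-dist₂ {ρ₁} {ρ₂} {ρ₃} _ _ _) =
  ++-lub (++-lub (⊆-trans (xs⊆xs++ys (lblT ρ₁) (lblT ρ₃)) (xs⊆xs++ys _ _))
                 (⊆-trans (xs⊆xs++ys (lblT ρ₂) (lblT ρ₃)) (xs⊆ys++xs _ (lblT ρ₁ ++ lblT ρ₃))))
         (⊆-trans (xs⊆ys++xs (lblT ρ₃) (lblT ρ₁)) (xs⊆xs++ys _ _))
lblT-antitone (≤-over₁ _ _ _) = there
lblT-antitone (≤-over₂ _ _ _) = ∈-∷⁺ʳ (here refl) ⊆-refl
lblT-antitone (≤-swap₁ _ _ _ _) (here e) = there (here e)
lblT-antitone (≤-swap₁ _ _ _ _) (there (here e)) = here e
lblT-antitone (≤-swap₁ _ _ _ _) (there (there p)) = there (there p)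
lblT-antitone (≤-swap₂ _ _ _ _) (here e) = there (here e)
lblT-antitone (≤-swap₂ _ _ _ _) (there (here e)) = here e
lblT-antitone (≤-swap₂ _ _ _ _) (there (there p)) = there (there p)
lblT-antitone (≤-+l {ρ = ρ} _ _ _ s) = ++⁺ˡ (lblT ρ) (lblT-antitone s)
lblT-antitone (≤-+r {ρ = ρ} _ _ _ s _) = ++⁺ʳ (lblT ρ) (lblT-antitone s)

lookup⇒∈lblF : ∀ {R l M} → R ∋ᶠ l ↦ M → l ∈ lblF R
lookup⇒∈lblF fhere = here refl
lookup⇒∈lblF (fthere p) = there (lookup⇒∈lblF p)

lookup-unique : ∀ {R l M M'} → Unique (lblF R) → R ∋ᶠ l ↦ M → R ∋ᶠ l ↦ M' → M ≡ M'
lookup-unique _ fhere fhere = refl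
lookup-unique (l∉R ∷ _) fhere (fthere q) = ⊥-elim (All-lookup l∉R (lookup⇒∈lblF q) refl)
lookup-unique (l∉R ∷ _) (fthere p) fhere = ⊥-elim (All-lookup l∉R (lookup⇒∈lblF p) refl)
lookup-unique (_ ∷ u) (fthere p) (fthere q) = lookup-unique u p q

HasField : Basis → Fields → Label → Ty → Set
HasField Γ R l σ = Σ[ M ∈ Term ] R ∋ᶠ l ↦ M × Γ ⊢ M ∶ σ

-- The labels in L are overridden by a right summand of +ᵣ, so R owes no field for them.
Realises : Basis → Fields → List Label → Ty → Set
Realises Γ R L ⟨ l ∶ σ ⟩ = l ∉ L → HasField Γ R l σ
Realises Γ R L (ρ₁ ∩ ρ₂) = Realises Γ R L ρ₁ × Realises Γ R L ρ₂
Realises Γ R L (ρ₁ +ᵣ ρ₂) = Realises Γ R (lblT ρ₂ ++ L) ρ₁ × Realises Γ R L ρ₂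
Realises Γ R L _ = ⊤

Realises-⊆ : ∀ {Γ R L L'} σ → L ⊆ L' → Realises Γ R L σ → Realises Γ R L' σ
Realises-⊆ ⟨ l ∶ σ ⟩ L⊆L' f l∉L' = f (λ l∈L → l∉L' (L⊆L' l∈L))
Realises-⊆ (σ ∩ τ) L⊆L' (a , b) = Realises-⊆ σ L⊆L' a , Realises-⊆ τ L⊆L' b
Realises-⊆ (σ +ᵣ τ) L⊆L' (a , b) =
  Realises-⊆ σ (++⁺ʳ (lblT τ) L⊆L') a , Realises-⊆ τ L⊆L' b
Realises-⊆ (atom _) _ o = o
Realises-⊆ ω _ o = o
Realises-⊆ (_ ⇒ _) _ o = o
Realises-⊆ ⟨⟩ _ o = o

Realises-embed : ∀ {Γ R R' L} σ → (∀ {l M} → l ∉ L → R ∋ᶠ l ↦ M → R' ∋ᶠ l ↦ M) →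
                 Realises Γ R L σ → Realises Γ R' L σ
Realises-embed ⟨ l ∶ σ ⟩ h f l∉L with f l∉L
... | M , p , d = M , h l∉L p , d
Realises-embed (σ ∩ τ) h (a , b) = Realises-embed σ h a , Realises-embed τ h b
Realises-embed (σ +ᵣ τ) h (a , b) =
  Realises-embed σ (λ l∉ → h (λ l∈ → l∉ (xs⊆ys++xs _ (lblT τ) l∈))) a , Realises-embed τ h b
Realises-embed (atom _) _ o = o
Realises-embed ω _ o = o
Realises-embed (_ ⇒ _) _ o = o
Realises-embed ⟨⟩ _ o = o

Realises-≤ : ∀ {Γ R σ τ} → Unique (lblF R) → σ ≤ τ → ∀ {L} → Realises Γ R L σ → Realises Γ R L τ
Realises-≤ u (≤-refl _) o = o
Realises-≤ u (≤-trans s t) o = Realises-≤ u t (Realises-≤ u s o)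
Realises-≤ u (≤-ω _) o = tt
Realises-≤ u ≤-ωω o = tt
Realises-≤ u (≤-∩l _ _) (o , _) = o
Realises-≤ u (≤-∩r _ _) (_ , o) = o
Realises-≤ u (≤-glb s t) o = Realises-≤ u s o , Realises-≤ u t o
Realises-≤ u (≤-⇒∩ _ _ _) o = tt
Realises-≤ u (≤-⇒ _ _) o = tt
Realises-≤ u (≤-fld⟨⟩ _) o = tt
Realises-≤ u (≤-fld∩ _ _) (f , g) l∉L with f l∉L | g l∉L
... | M , p , d | _ , p' , d' rewrite lookup-unique u p' p = M , p , ⊢∩ d d'
Realises-≤ u (≤-fld s) f l∉L with f l∉L
... | M , p , d = M , p , ⊢≤ d s
Realises-≤ u (≤-unitr₁ _) (o , _) = o
Realises-≤ u (≤-unitr₂ _) o = o , tt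
Realises-≤ u (≤-unitl₁ _) (_ , o) = o
Realises-≤ u (≤-unitl₂ _) o = tt , o
Realises-≤ u (≤-assoc₁ {ρ₁} {ρ₂} {ρ₃} _ _ _) {L} ((a , b) , c) =
  Realises-⊆ ρ₁ (⊆-reflexive (sym (++-assoc (lblT ρ₂) (lblT ρ₃) L))) a , b , c
Realises-≤ u (≤-assoc₂ {ρ₁} {ρ₂} {ρ₃} _ _ _) {L} (a , b , c) =
  (Realises-⊆ ρ₁ (⊆-reflexive (++-assoc (lblT ρ₂) (lblT ρ₃) L)) a , b) , c
Realises-≤ u (≤-dist₁ _ _ _) ((a , b) , c) = (a , c) , (b , c)
Realises-≤ u (≤-dist₂ _ _ _) ((a , c) , (b , _)) = (a , b) , c
Realises-≤ u (≤-over₁ _ _ _) (_ , o) = o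
Realises-≤ u (≤-over₂ _ _ _) o = (λ l∉ → ⊥-elim (l∉ (here refl))) , o
Realises-≤ u (≤-swap₁ l≢l' _ _ _) (a , b , c) =
  b , (λ l∉L → a λ { (here l≡l') → l≢l' l≡l' ; (there l∈L) → l∉L l∈L }) , c
Realises-≤ u (≤-swap₂ _ _ _ _) (b , a , c) = (λ l∉ → a (λ l∈L → l∉ (there l∈L))) , b , c
Realises-≤ u (≤-+l _ _ _ s) (a , b) = Realises-≤ u s a , b
Realises-≤ u (≤-+r {ρ = ρ} _ _ _ s t) {L} (a , b) =
  Realises-⊆ ρ (++⁺ˡ L (lblT-antitone t)) a , Realises-≤ u s b

⊢rec⇒Realises : ∀ {Γ R σ} → Unique (lblF R) → Γ ⊢ rec R ∶ σ → Realises Γ R [] σ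
⊢rec⇒Realises u (⊢∩ d e) = ⊢rec⇒Realises u d , ⊢rec⇒Realises u e
⊢rec⇒Realises u ⊢ω = tt
⊢rec⇒Realises u (⊢≤ d s) = Realises-≤ u s (⊢rec⇒Realises u d)
⊢rec⇒Realises u ⊢⟨⟩ = tt
⊢rec⇒Realises u (⊢fld p d) = λ _ → _ , p , d

Flat : Set
Flat = List (Label × Ty)

flatTy : Flat → Ty
flatTy [] = ⟨⟩
flatTy ((l , σ) ∷ F) = ⟨ l ∶ σ ⟩ ∩ flatTy F

labels : Flat → List Label
labels = map proj₁

TypFlat : Flat → Set
TypFlat = All (λ (_ , σ) → Typ σ)

Rec-flatTy : ∀ {F} → TypFlat F → Rec (flatTy F)
Rec-flatTy [] = r-⟨⟩
Rec-flatTy (t ∷ ts) = r-∩ (r-fld t) (Rec-flatTy ts)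

FieldsTyped : Basis → Fields → Flat → Set
FieldsTyped Γ R = All (λ (l , σ) → HasField Γ R l σ)

FieldsTyped⇒⊢rec : ∀ {Γ R F} → FieldsTyped Γ R F → Γ ⊢ rec R ∶ flatTy F
FieldsTyped⇒⊢rec [] = ⊢⟨⟩
FieldsTyped⇒⊢rec ((_ , p , d) ∷ fs) = ⊢∩ (⊢fld p d) (FieldsTyped⇒⊢rec fs)

flatten : Ty → Flat → Flat
flatten ⟨ l ∶ σ ⟩ F with l ∈? labels F
... | yes _ = F
... | no _ = (l , σ) ∷ F
flatten (ρ₁ ∩ ρ₂) F = flatten ρ₁ F ++ flatten ρ₂ F
flatten (ρ₁ +ᵣ ρ₂) F = flatten ρ₁ (flatten ρ₂ F)
flatten _ F = F

TypFlat-flatten : ∀ {ρ F} → Rec ρ → TypFlat F → TypFlat (flatten ρ F)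
TypFlat-flatten r-⟨⟩ tF = tF
TypFlat-flatten {⟨ l ∶ _ ⟩} {F} (r-fld t) tF with l ∈? labels F
... | yes _ = tF
... | no _ = t ∷ tF
TypFlat-flatten (r-+ r₁ r₂) tF = TypFlat-flatten r₁ (TypFlat-flatten r₂ tF)
TypFlat-flatten (r-∩ r₁ r₂) tF = All-++⁺ (TypFlat-flatten r₁ tF) (TypFlat-flatten r₂ tF)

labels-++ : ∀ F G → labels (F ++ G) ≡ labels F ++ labels G
labels-++ = map-++ proj₁

labels-flatten : ∀ {ρ F} → Rec ρ → lblT ρ ++ labels F ⊆ labels (flatten ρ F)
labels-flatten r-⟨⟩ = ⊆-refl
labels-flatten {⟨ l ∶ _ ⟩} {F} (r-fld _) with l ∈? labels F
... | yes l∈F = ∈-∷⁺ʳ l∈F ⊆-refl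
... | no _ = ⊆-refl
labels-flatten {ρ₁ +ᵣ ρ₂} {F} (r-+ r₁ r₂) =
  ⊆-trans (⊆-reflexive (++-assoc (lblT ρ₁) (lblT ρ₂) (labels F)))
          (⊆-trans (++⁺ʳ (lblT ρ₁) (labels-flatten r₂)) (labels-flatten r₁))
labels-flatten {ρ₁ ∩ ρ₂} {F} (r-∩ r₁ r₂) =
  ⊆-trans (++-lub (++-lub (⊆-trans (xs⊆xs++ys _ (labels F)) (⊆-trans (labels-flatten r₁) ˡ))
                          (⊆-trans (xs⊆xs++ys _ (labels F)) (⊆-trans (labels-flatten r₂) ʳ)))
                  (⊆-trans (xs⊆ys++xs _ (lblT ρ₁)) (⊆-trans (labels-flatten r₁) ˡ)))
          (⊆-reflexive (sym (labels-++ (flatten ρ₁ F) (flatten ρ₂ F))))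
  where
    ˡ = xs⊆xs++ys (labels (flatten ρ₁ F)) (labels (flatten ρ₂ F))
    ʳ = xs⊆ys++xs (labels (flatten ρ₂ F)) (labels (flatten ρ₁ F))

FieldsTyped-flatten : ∀ {Γ R ρ F} → Rec ρ → Realises Γ R (labels F) ρ →
                      FieldsTyped Γ R F → FieldsTyped Γ R (flatten ρ F)
FieldsTyped-flatten r-⟨⟩ _ fs = fs
FieldsTyped-flatten {ρ = ⟨ l ∶ _ ⟩} {F} (r-fld _) f fs with l ∈? labels F
... | yes _ = fs
... | no l∉F = f l∉F ∷ fs
FieldsTyped-flatten {ρ = ρ₁ +ᵣ _} (r-+ r₁ r₂) (a , b) fs =
  FieldsTyped-flatten r₁ (Realises-⊆ ρ₁ (labels-flatten r₂) a) (FieldsTyped-flatten r₂ b fs)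
FieldsTyped-flatten (r-∩ r₁ r₂) (a , b) fs =
  All-++⁺ (FieldsTyped-flatten r₁ a fs) (FieldsTyped-flatten r₂ b fs)

flatTy-≤⟨⟩ : ∀ {F} → TypFlat F → flatTy F ≤ ⟨⟩
flatTy-≤⟨⟩ [] = ≤-refl (t-rec r-⟨⟩)
flatTy-≤⟨⟩ (t ∷ ts) = ≤-trans (≤-∩l (t-rec (r-fld t)) (t-rec (Rec-flatTy ts))) (≤-fld⟨⟩ t)

flatTy-++ : ∀ {F G} → TypFlat F → TypFlat G → flatTy (F ++ G) ≃ flatTy F ∩ flatTy G
flatTy-++ [] tG = ≤-glb (flatTy-≤⟨⟩ tG) (≤-refl (t-rec (Rec-flatTy tG))) ,
                  ≤-∩r (t-rec r-⟨⟩) (t-rec (Rec-flatTy tG))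
flatTy-++ (t ∷ tF) tG =
  ≃-trans (∩-cong (≃-refl (t-rec (r-fld t))) (flatTy-++ tF tG))
          (∩-assoc (t-rec (r-fld t)) (t-rec (Rec-flatTy tF)) (t-rec (Rec-flatTy tG)))

field+flatTy-absorb : ∀ {l σ F} → Typ σ → TypFlat F → l ∈ labels F →
                      ⟨ l ∶ σ ⟩ +ᵣ flatTy F ≃ flatTy F
field+flatTy-absorb tσ (t ∷ ts) (here refl) = ≤-over₁ tσ t (Rec-flatTy ts) , ≤-over₂ tσ t (Rec-flatTy ts)
field+flatTy-absorb {l} {F = (l' , _) ∷ _} tσ (t ∷ ts) (there l∈F) with l ≟ℕ l'
... | yes refl = ≤-over₁ tσ t (Rec-flatTy ts) , ≤-over₂ tσ t (Rec-flatTy ts)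
... | no l≢l' =
  ≃-trans (≤-swap₁ l≢l' tσ t (Rec-flatTy ts) , ≤-swap₂ l≢l' tσ t (Rec-flatTy ts))
          (∩-cong (≃-refl (t-rec (r-fld t))) (field+flatTy-absorb tσ ts l∈F))

field+flatTy-fresh : ∀ {l σ F} → Typ σ → TypFlat F → l ∉ labels F →
                     ⟨ l ∶ σ ⟩ +ᵣ flatTy F ≃ ⟨ l ∶ σ ⟩ ∩ flatTy F
field+flatTy-fresh tσ [] _ =
  ≃-trans (≤-unitr₁ (r-fld tσ) , ≤-unitr₂ (r-fld tσ))
          (≤-glb (≤-refl (t-rec (r-fld tσ))) (≤-fld⟨⟩ tσ) , ≤-∩l (t-rec (r-fld tσ)) (t-rec r-⟨⟩))
field+flatTy-fresh tσ (t ∷ ts) l∉F =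
  ≃-trans (≤-swap₁ l≢l' tσ t (Rec-flatTy ts) , ≤-swap₂ l≢l' tσ t (Rec-flatTy ts))
          (≃-trans (∩-cong (≃-refl (t-rec (r-fld t))) (field+flatTy-fresh tσ ts (λ l∈ → l∉F (there l∈))))
                   (x∩yz≃y∩xz (t-rec (r-fld t)) (t-rec (r-fld tσ)) (t-rec (Rec-flatTy ts))))
  where
    l≢l' = λ l≡l' → l∉F (here l≡l')

flatten-≃ : ∀ {ρ F} → Rec ρ → TypFlat F → ρ +ᵣ flatTy F ≃ flatTy (flatten ρ F)
flatten-≃ r-⟨⟩ tF = ≤-unitl₁ (Rec-flatTy tF) , ≤-unitl₂ (Rec-flatTy tF)
flatten-≃ {⟨ l ∶ _ ⟩} {F} (r-fld t) tF with l ∈? labels F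
... | yes l∈F = field+flatTy-absorb t tF l∈F
... | no l∉F = field+flatTy-fresh t tF l∉F
flatten-≃ (r-∩ r₁ r₂) tF =
  ≃-trans (≤-dist₁ r₁ r₂ (Rec-flatTy tF) , ≤-dist₂ r₁ r₂ (Rec-flatTy tF))
  (≃-trans (∩-cong (flatten-≃ r₁ tF) (flatten-≃ r₂ tF))
           (≃-sym (flatTy-++ (TypFlat-flatten r₁ tF) (TypFlat-flatten r₂ tF))))
flatten-≃ (r-+ r₁ r₂) tF =
  ≃-trans (≤-assoc₁ r₁ r₂ (Rec-flatTy tF) , ≤-assoc₂ r₁ r₂ (Rec-flatTy tF))
  (≃-trans (≤-+r rF rF' r₁ ≤₂ ≥₂ , ≤-+r rF' rF r₁ ≥₂ ≤₂)
           (flatten-≃ r₁ (TypFlat-flatten r₂ tF)))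
  where
    rF = r-+ r₂ (Rec-flatTy tF)
    rF' = Rec-flatTy (TypFlat-flatten r₂ tF)
    ≤₂ = proj₁ (flatten-≃ r₂ tF)
    ≥₂ = proj₂ (flatten-≃ r₂ tF)

Realises⇒⊢rec : ∀ {Γ R ρ} → Rec ρ → Realises Γ R [] ρ → Γ ⊢ rec R ∶ ρ
Realises⇒⊢rec r o =
  ⊢≤ (FieldsTyped⇒⊢rec (FieldsTyped-flatten r o []))
     (≤-trans (proj₂ (flatten-≃ r [])) (≤-unitr₁ r))

++F-lookupˡ : ∀ {R S l M} → R ∋ᶠ l ↦ M → (R ++F S) ∋ᶠ l ↦ M
++F-lookupˡ fhere = fhere
++F-lookupˡ (fthere p) = fthere (++F-lookupˡ p)

++F-lookupʳ : ∀ {R S l M} → S ∋ᶠ l ↦ M → (R ++F S) ∋ᶠ l ↦ M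
++F-lookupʳ {fnil} p = p
++F-lookupʳ {fcons _ _ R} p = fthere (++F-lookupʳ {R} p)

∉⇒elem≡false : ∀ {l} ls → l ∉ ls → elem l ls ≡ false
∉⇒elem≡false [] _ = refl
∉⇒elem≡false {l} (k ∷ ks) l∉ with l ≡ᵇ k in eq
... | true = ⊥-elim (l∉ (here (≡ᵇ⇒≡ l k (≡-subst T (sym eq) tt))))
... | false = ∉⇒elem≡false ks (λ l∈ → l∉ (there l∈))

removeL-lookup : ∀ {ls R l M} → R ∋ᶠ l ↦ M → l ∉ ls → removeL ls R ∋ᶠ l ↦ M
removeL-lookup {ls} fhere l∉ rewrite ∉⇒elem≡false ls l∉ = fhere
removeL-lookup {ls} (fthere {l' = l'} p) l∉ with elem l' ls
... | true = removeL-lookup p l∉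
... | false = fthere (removeL-lookup p l∉)

⊢mergeF : ∀ {Γ R S ρ₁ ρ₂} → Unique (lblF R) → Unique (lblF S) → Rec ρ₁ → Rec ρ₂ →
          Γ ⊢ rec R ∶ ρ₁ → Γ ⊢ rec S ∶ ρ₂ → SameLabels (lblF S) (lblT ρ₂) →
          Γ ⊢ rec (mergeF R S) ∶ ρ₁ +ᵣ ρ₂
⊢mergeF {Γ} {R} {S} {ρ₁} {ρ₂} uR uS r₁ r₂ d e (S⊆ρ₂ , _) =
  Realises⇒⊢rec (r-+ r₁ r₂) (left , right)
  where
    kept : ∀ {l M} → l ∉ lblT ρ₂ ++ [] → R ∋ᶠ l ↦ M → mergeF R S ∋ᶠ l ↦ M
    kept l∉ρ₂ p = ++F-lookupˡ (removeL-lookup p (λ l∈S → l∉ρ₂ (xs⊆xs++ys _ [] (S⊆ρ₂ _ l∈S))))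

    left : Realises Γ (mergeF R S) (lblT ρ₂ ++ []) ρ₁
    left = Realises-embed ρ₁ kept (Realises-⊆ ρ₁ (λ ()) (⊢rec⇒Realises uR d))

    right : Realises Γ (mergeF R S) [] ρ₂
    right = Realises-embed ρ₂ (λ _ → ++F-lookupʳ) (⊢rec⇒Realises uS e)

⊢proj : ∀ {Γ R l M σ} → Unique (lblF R) → Γ ⊢ rec R ∶ ⟨ l ∶ σ ⟩ → R ∋ᶠ l ↦ M → Γ ⊢ M ∶ σ
⊢proj u d p with ⊢rec⇒Realises u d (λ ())
... | _ , p' , d' rewrite lookup-unique u p' p = d'

⟶ᶠ-lookup : ∀ {R R' l M} → R ⟶ᶠ R' → R ∋ᶠ l ↦ M →
            R' ∋ᶠ l ↦ M ⊎ Σ[ M' ∈ Term ] R' ∋ᶠ l ↦ M' × M ⟶ M'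
⟶ᶠ-lookup (fstep-here s) fhere = inj₂ (_ , fhere , s)
⟶ᶠ-lookup (fstep-here _) (fthere p) = inj₁ (fthere p)
⟶ᶠ-lookup (fstep-there _) fhere = inj₁ fhere
⟶ᶠ-lookup (fstep-there s) (fthere p) with ⟶ᶠ-lookup s p
... | inj₁ q = inj₁ (fthere q)
... | inj₂ (M' , q , t) = inj₂ (M' , fthere q , t)

⟶ᶠ-lblF : ∀ {R R'} → R ⟶ᶠ R' → lblF R' ≡ lblF R
⟶ᶠ-lblF (fstep-here _) = refl
⟶ᶠ-lblF (fstep-there {l = l} s) = cong (l ∷_) (⟶ᶠ-lblF s)

WFF-lookup : ∀ {R l M} → WFF R → R ∋ᶠ l ↦ M → WF M
WFF-lookup (wf-fcons w _) fhere = w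
WFF-lookup (wf-fcons _ ws) (fthere p) = WFF-lookup ws p

⟶-preserves-⊢ : ∀ {Γ M N σ} → WF M → Γ ⊢ M ∶ σ → M ⟶ N → Γ ⊢ N ∶ σ
⟶-preserves-⊢ w (⊢∩ d e) s = ⊢∩ (⟶-preserves-⊢ w d s) (⟶-preserves-⊢ w e s)
⟶-preserves-⊢ w ⊢ω s = ⊢ω
⟶-preserves-⊢ w (⊢≤ d σ≤τ) s = ⊢≤ (⟶-preserves-⊢ w d s) σ≤τ
⟶-preserves-⊢ (wf-ƛ w) (⊢ƛ t d) (ξ-ƛ s) = ⊢ƛ t (⟶-preserves-⊢ w d s)
⟶-preserves-⊢ w (⊢· d e) β = ⊢ƛ⇒Body d e
⟶-preserves-⊢ (wf-· w _) (⊢· d e) (ξ-·₁ s) = ⊢· (⟶-preserves-⊢ w d s) e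
⟶-preserves-⊢ (wf-· _ w) (⊢· d e) (ξ-·₂ s) = ⊢· d (⟶-preserves-⊢ w e s)
⟶-preserves-⊢ w ⊢⟨⟩ (ξ-rec s) = ⊢⟨⟩
⟶-preserves-⊢ (wf-rec ws _) (⊢fld p d) (ξ-rec s) with ⟶ᶠ-lookup s p
... | inj₁ p' = ⊢fld p' d
... | inj₂ (_ , p' , t) = ⊢fld p' (⟶-preserves-⊢ (WFF-lookup ws p) d t)
⟶-preserves-⊢ (wf-∙ (wf-rec _ u)) (⊢sel d) (proj p) = ⊢proj u d p
⟶-preserves-⊢ (wf-∙ w) (⊢sel d) (ξ-∙ s) = ⊢sel (⟶-preserves-⊢ w d s)
⟶-preserves-⊢ (wf-⊕ (wf-rec _ uR) _ uS) (⊢⊕ r₁ r₂ d e sl) merge = ⊢mergeF uR uS r₁ r₂ d e sl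
⟶-preserves-⊢ (wf-⊕ w _ _) (⊢⊕ r₁ r₂ d e sl) (ξ-⊕₁ s) = ⊢⊕ r₁ r₂ (⟶-preserves-⊢ w d s) e sl
⟶-preserves-⊢ (wf-⊕ _ ws u) (⊢⊕ r₁ r₂ d e sl) (ξ-⊕₂ s) =
  ⊢⊕ r₁ r₂ d (⟶-preserves-⊢ (wf-rec ws u) e (ξ-rec s))
     (≡-subst (λ ls → SameLabels ls _) (sym (⟶ᶠ-lblF s)) sl)

theorem3p16 : (Γ : Basis) (M N : Term) (σ : Ty) →
    WFBasis Γ → WF M → Typ σ →
    Γ ⊢ M ∶ σ → M ⟶ N → Γ ⊢ N ∶ σ
theorem3p16 Γ M N σ _ wfM _ ⊢M M⟶N = ⟶-preserves-⊢ wfM ⊢M M⟶N
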